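{- Let $f$ be a Boolean network, $\mathcal{X}\subseteq\mathrm{var}(f)$, $g$ the Boolean network obtained from $f$ and $\mathcal{X}$ by the perturbation transformation, and $\Delta=\bigcup_{v\in\mathcal{X}}\{v^k,v^o\}$. If $m$ is a minimal trap space of $g$, then $m(u)\neq\star$ for every $u\in\Delta$.
   Context: A Boolean network (BN) $f$ has a finite variable set $\mathrm{var}(f)$ and for each $v$ a Boolean function $f_v$ over $\mathrm{var}(f)$. A sub-space is a map $m:\mathrm{var}(f)\to\{0,1,\star\}$ representing $S[m]=\{s\in\{0,1\}^{\mathrm{var}(f)}: s_v=m(v)\text{ whenever }m(v)\ne\star\}$. A trap space is a sub-space $m$ such that for every $s\in S[m]$ and every $v$ with $m(v)\ne\star$, $f_v(s)=m(v)$; it is minimal if no trap space $m'$ has $S[m']\subsetneq S[m]$. Perturbation transformation: $g$ has variables $\mathrm{var}(f)\cup\Delta$ (with $v^k,v^o$ fresh), $g_v=f_v$ for $v\in\mathrm{var}(f)\setminus\mathcal{X}$, and for $v\in\mathcal{X}$: $g_v=\neg v^k\wedge(v^o\vee f_v)$, $g_{v^k}=v^k$, $g_{v^o}=v^o\wedge\neg v^k$. -}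

module Defs where

open import Data.Bool using (Bool; true; false; _∧_; _∨_; not)
open import Data.Maybe using (Maybe; just; nothing)
open import Data.Nat using (ℕ)
open import Data.Fin using (Fin)
open import Data.Empty using (⊥)
open import Data.Unit using (⊤)
open import Data.Fin.Subset using (Subset; _∈_)
open import Data.Fin.Subset.Properties using (_∈?_)
open import Data.Product using (_×_; ∃-syntax)
open import Relation.Binary.PropositionalEquality using (_≡_)
open import Relation.Nullary using (¬_; yes; no)

State : Set → Set
State V = V → Bool

BN : Set → Set
BN V = V → State V → Bool

-- Sub-space: nothing represents ⋆, just b a fixed value
SubSpace : Set → Set
SubSpace V = V → Maybe Bool

_∈S_ : {V : Set} → State V → SubSpace V → Set
s ∈S m = ∀ v b → m v ≡ just b → s v ≡ b

_⊊S_ : {V : Set} → SubSpace V → SubSpace V → Set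
m' ⊊S m = (∀ s → s ∈S m' → s ∈S m) × (∃[ s ] (s ∈S m × ¬ (s ∈S m')))

IsTrapSpace : {V : Set} → BN V → SubSpace V → Set
IsTrapSpace f m = ∀ s → s ∈S m → ∀ v b → m v ≡ just b → f v s ≡ b

IsMinimalTrapSpace : {V : Set} → BN V → SubSpace V → Set
IsMinimalTrapSpace f m =
  IsTrapSpace f m × (∀ m' → IsTrapSpace f m' → ¬ (m' ⊊S m))

-- Variables of the perturbed network g: var(f) ∪ Δ,
-- with Δ = { v^k, v^o | v ∈ X }
data PVar (n : ℕ) (X : Subset n) : Set where
  old   : Fin n → PVar n X
  knock : (v : Fin n) → v ∈ X → PVar n X
  over  : (v : Fin n) → v ∈ X → PVar n X

InΔ : {n : ℕ} {X : Subset n} → PVar n X → Set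
InΔ (old _)     = ⊥
InΔ (knock _ _) = ⊤
InΔ (over _ _)  = ⊤

perturb : {n : ℕ} → BN (Fin n) → (X : Subset n) → BN (PVar n X)
perturb {n} f X (old v) s with v ∈? X
... | yes p = not (s (knock v p)) ∧ (s (over v p) ∨ f v (λ w → s (old w)))
... | no _  = f v (λ w → s (old w))
perturb f X (knock v p) s = s (knock v p)
perturb f X (over v p) s = s (over v p) ∧ not (s (knock v p))

module Submission where

open import Defs
open import Data.Nat using (ℕ)
open import Data.Fin using (Fin)
open import Data.Fin.Subset using (Subset)
open import Data.Maybe using (just; nothing; maybe′; _<∣>_)
import Data.Maybe as Maybe
open import Data.Bool using (true; false; not)
open import Data.Bool.Properties using (not-¬; ∧-idem)
open import Data.Product using (_,_; proj₁)
open import Function using (id)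
open import Relation.Binary.PropositionalEquality

-- In a trap space m of the perturbed network, every free v^k may be
-- fixed to 1 (g_{v^k} = v^k), and once v^k is fixed to c, v^o may be fixed to ¬c
-- (g_{v^o} = v^o ∧ ¬v^k). Both refinements are again trap spaces, so a minimal
-- trap space leaves no variable of Δ free.

module _ {V : Set} where

  refine : SubSpace V → SubSpace V → SubSpace V
  refine m r v = m v <∣> r v

  refine-fixed : ∀ m r v {b} → m v ≡ just b → refine m r v ≡ just b
  refine-fixed m r v eq rewrite eq = refl

  refine-free : ∀ m r v → m v ≡ nothing → refine m r v ≡ r v
  refine-free m r v eq rewrite eq = refl

  ∈S-refine⇒∈S : ∀ m r s → s ∈S refine m r → s ∈S m
  ∈S-refine⇒∈S m r s s∈ v b eq = s∈ v b (refine-fixed m r v eq)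

  refine-⊊S : ∀ m r u {c} → m u ≡ nothing → r u ≡ just c → refine m r ⊊S m
  refine-⊊S m r u {c} free fixed =
    ∈S-refine⇒∈S m r , (s , s∈m , λ s∈ → not-¬ refl (trans (sym (s∈ u c u-fixed)) s-u))
    where
      s : State V
      s v = maybe′ id (maybe′ not false (r v)) (m v)

      s∈m : s ∈S m
      s∈m v b eq rewrite eq = refl

      u-fixed : refine m r u ≡ just c
      u-fixed = trans (refine-free m r u free) fixed

      s-u : s u ≡ not c
      s-u rewrite free | fixed = refl

  refine-isTrapSpace : ∀ (f : BN V) m r → IsTrapSpace f m →
    (∀ s → s ∈S refine m r → ∀ v b → m v ≡ nothing → r v ≡ just b → f v s ≡ b) →
    IsTrapSpace f (refine m r)
  refine-isTrapSpace f m r trap new s s∈ v b eq with m v in mv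
  ... | just _  = trap s (∈S-refine⇒∈S m r s s∈) v b (trans mv eq)
  ... | nothing = new s s∈ v b mv eq

  minimal⇒refine-fixes-no-free : ∀ (f : BN V) m r u {c} → IsMinimalTrapSpace f m →
    IsTrapSpace f (refine m r) → m u ≡ nothing → r u ≢ just c
  minimal⇒refine-fixes-no-free f m r u (_ , minimal) trap free fixed =
    minimal (refine m r) trap (refine-⊊S m r u free fixed)

module _ {n : ℕ} {X : Subset n} where

  fixΔ : SubSpace (PVar n X) → SubSpace (PVar n X)
  fixΔ m (old _)     = nothing
  fixΔ m (knock _ _) = just true
  fixΔ m (over v p)  = Maybe.map not (m (knock v p))

  refine-fixΔ-isTrapSpace : ∀ (f : BN (Fin n)) m → IsTrapSpace (perturb f X) m →
                            IsTrapSpace (perturb f X) (refine m (fixΔ m))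
  refine-fixΔ-isTrapSpace f m trap = refine-isTrapSpace (perturb f X) m (fixΔ m) trap new
    where
      new : ∀ s → s ∈S refine m (fixΔ m) → ∀ u b →
            m u ≡ nothing → fixΔ m u ≡ just b → perturb f X u s ≡ b
      new s s∈ (old _) b free ()
      new s s∈ (knock v p) b free refl =
        s∈ (knock v p) true (refine-free m (fixΔ m) (knock v p) free)
      new s s∈ (over v p) b free eq with m (knock v p) in mk
      new s s∈ (over v p) b free refl | just c
        rewrite s∈ (over v p) (not c)
                  (trans (refine-free m (fixΔ m) (over v p) free)
                         (cong (Maybe.map not) mk))
              | ∈S-refine⇒∈S m (fixΔ m) s s∈ (knock v p) c mk
        = ∧-idem (not c)

lemma1 : (n : ℕ) (f : BN (Fin n)) (X : Subset n) (m : SubSpace (PVar n X)) →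
    IsMinimalTrapSpace (perturb f X) m →
    (u : PVar n X) → InΔ u → m u ≢ nothing
lemma1 n f X m minimal = freeΔ
  where
    trap : IsTrapSpace (perturb f X) (refine m (fixΔ m))
    trap = refine-fixΔ-isTrapSpace f m (proj₁ minimal)

    noFreeRefined : ∀ u {c} → m u ≡ nothing → fixΔ m u ≢ just c
    noFreeRefined u = minimal⇒refine-fixes-no-free (perturb f X) m (fixΔ m) u minimal trap

    freeΔ : (u : PVar n X) → InΔ u → m u ≢ nothing
    freeΔ (knock v p) _ free = noFreeRefined (knock v p) free refl
    freeΔ (over v p)  _ free with m (knock v p) in mk
    ... | nothing = noFreeRefined (knock v p) mk refl
    ... | just c  = noFreeRefined (over v p) free (cong (Maybe.map not) mk)
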